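{- Let $m\geq 3$ and let $n\geq 5$ be odd. For any two distinct vertices lying in the same column of $P_m\Box C_n$, there is a 2-factor of $P_m\Box C_n$ separating them.
   Context: $P_m$ is the path of order $m$ and $C_n$ the cycle of order $n$. The vertices of $P_m\Box C_n$ are $u_{i,j}$ with $0\le i\le m-1$ and $j\in\mathbb{Z}_n$; edges are $[u_{i,j},u_{i,j+1}]$ for all $i,j$ (second index mod $n$) and $[u_{i,j},u_{i+1,j}]$ for $0\le i\le m-2$. The $i$-column is the set $\{u_{i,j}: j\in\mathbb{Z}_n\}$. A 2-factor is a spanning subgraph in which every vertex has valency 2. A 2-factor separates a set $A$ of $k$ vertices if it consists of exactly $k$ cycles and $A$ meets the vertex set of each cycle in exactly one vertex. -}

module Defs where

open import Data.Nat using (ℕ; zero; suc; _+_; _*_; _∸_)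
open import Data.Fin using (Fin; toℕ)
open import Data.Product using (_×_; Σ; ∃; ∃-syntax; _,_)
open import Data.Sum using (_⊎_)
open import Data.Bool using (Bool; T)
open import Relation.Binary.PropositionalEquality using (_≡_; _≢_)
open import Relation.Binary.Construct.Closure.ReflexiveTransitive using (Star)
open import Relation.Nullary using (¬_)

Odd : ℕ → Set
Odd n = ∃[ k ] n ≡ suc (2 * k)

Vertex : ℕ → ℕ → Set
Vertex m n = Fin m × Fin n

CycSucc : (n : ℕ) → Fin n → Fin n → Set
CycSucc n j j' = (toℕ j' ≡ suc (toℕ j)) ⊎ (toℕ j ≡ n ∸ 1 × toℕ j' ≡ 0)

PathSucc : (m : ℕ) → Fin m → Fin m → Set
PathSucc m i i' = toℕ i' ≡ suc (toℕ i)

Step : (m n : ℕ) → Vertex m n → Vertex m n → Set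
Step m n (i , j) (i' , j') = (i ≡ i' × CycSucc n j j') ⊎ (PathSucc m i i' × j ≡ j')

Adj : (m n : ℕ) → Vertex m n → Vertex m n → Set
Adj m n u v = Step m n u v ⊎ Step m n v u

-- a spanning subgraph, given by its edge set F (F u v = true iff [u,v] is an edge)
-- is a 2-factor if F is symmetric, consists of edges of the graph, and every
-- vertex has valency exactly 2.
record IsTwoFactor (m n : ℕ) (F : Vertex m n → Vertex m n → Bool) : Set where
  field
    symmetric : ∀ u v → T (F u v) → T (F v u)
    edges     : ∀ u v → T (F u v) → Adj m n u v
    valency2  : ∀ u → Σ (Vertex m n) λ v → Σ (Vertex m n) λ w →
                  v ≢ w × T (F u v) × T (F u w) ×
                  (∀ x → T (F u x) → x ≡ v ⊎ x ≡ w)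

Connected : {m n : ℕ} → (Vertex m n → Vertex m n → Bool) → Vertex m n → Vertex m n → Set
Connected F = Star (λ u v → T (F u v))

-- the 2-factor F separates {a , b} (a ≠ b): F has exactly 2 cycles and each
-- cycle contains exactly one of a, b.  Equivalently: every vertex lies on the
-- cycle of a or on the cycle of b, and a, b lie on different cycles.
Separates : {m n : ℕ} → (Vertex m n → Vertex m n → Bool) → Vertex m n → Vertex m n → Set
Separates F a b = (∀ u → Connected F a u ⊎ Connected F b u) × ¬ Connected F a b

{-# OPTIONS --safe #-}
-- Rotating the rows and possibly swapping the two vertices, we may assume they are u_{i,0} and
-- u_{i,j'} with j' ∉ {0, 1}.  Choose core columns k, k + 1 containing column i.  The 2-factor is
-- the 4-cycle on rows 0, 1 of the core columns together with a Hamiltonian cycle of all other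
-- vertices, grown by ears: rows 2, …, n − 1 of the core columns form a ladder cycle, and the
-- column at distance t from the core is spliced in by replacing the edge between rows gap t and
-- gap t + 1 of its inner neighbour with the two rungs at these rows and the path formed by the
-- new column minus its own edge between them.  The gap rows alternate between 2 and 3, so the two
-- edges a column gives up for its neighbours are distinct.  Membership in the square is invariant
-- along edges, so there are exactly two cycles.
module Submission where

open import Defs
open import Data.Bool using (Bool; true; false; T; not; _∧_; _∨_; if_then_else_)
open import Data.Bool.ListAction using (any)
open import Data.Bool.Properties using (∧-zeroʳ; ∧-identityʳ; T-∧; T-∨; T-≡)
open import Data.Empty using (⊥-elim)
open import Data.Fin using (Fin; toℕ; fromℕ<) renaming (zero to fzero; _≟_ to _≟ᶠ_)
open import Data.Fin.Properties using (toℕ-fromℕ<; toℕ-injective; toℕ<n)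
open import Data.List using (List; []; _∷_)
open import Data.List.Relation.Unary.Any using (here; there; satisfied)
open import Data.List.Relation.Unary.Any.Properties using (any⁺; any⁻)
open import Data.Nat
  using (ℕ; zero; suc; pred; _+_; _∸_; _≤_; _<_; z≤n; s≤s; _≡ᵇ_; _<ᵇ_; _≤ᵇ_; ∣_-_∣)
open import Data.Nat.Properties
open import Data.Product using (Σ; _×_; _,_; proj₁; proj₂)
open import Data.Product.Properties using (≡-dec)
open import Data.Sum using (_⊎_; inj₁; inj₂; [_,_]′)
open import Function.Base using (_∘_)
open import Function.Bundles using (Equivalence)
open import Relation.Binary.Construct.Closure.ReflexiveTransitive
  using (Star; ε; _◅_; _◅◅_; gmap; fold; reverse)
open import Relation.Binary.Definitions using (DecidableEquality; tri<; tri≈; tri>)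
open import Relation.Binary.PropositionalEquality
  using (_≡_; _≢_; refl; sym; trans; cong; cong₂; subst; subst₂; module ≡-Reasoning)
open import Relation.Nullary using (¬_; Dec; yes; no)
open import Relation.Nullary.Decidable using (True; toWitness; fromWitness; ⌊_⌋)

≡ᵇ-refl : ∀ a → (a ≡ᵇ a) ≡ true
≡ᵇ-refl zero    = refl
≡ᵇ-refl (suc a) = ≡ᵇ-refl a

≡ᵇ-false : ∀ {a b} → a ≢ b → (a ≡ᵇ b) ≡ false
≡ᵇ-false {a} {b} a≢b with a ≡ᵇ b in e
... | true  = ⊥-elim (a≢b (≡ᵇ⇒≡ a b (subst T (sym e) _)))
... | false = refl

<ᵇ-true : ∀ {a b} → a < b → (a <ᵇ b) ≡ true
<ᵇ-true a<b = Equivalence.to T-≡ (<⇒<ᵇ a<b)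

<ᵇ-false : ∀ {a b} → b ≤ a → (a <ᵇ b) ≡ false
<ᵇ-false {a} {b} b≤a with a <ᵇ b in e
... | true  = ⊥-elim (≤⇒≯ b≤a (<ᵇ⇒< a b (subst T (sym e) _)))
... | false = refl

SeparatingTwoFactor : (m n : ℕ) → Vertex m n → Vertex m n → Set
SeparatingTwoFactor m n a b =
  Σ (Vertex m n → Vertex m n → Bool) λ F → IsTwoFactor m n F × Separates F a b

module _ {m n : ℕ} {F : Vertex m n → Vertex m n → Bool} (F-sym : ∀ u v → T (F u v) → T (F v u)) where

  Connected-sym : ∀ {u v} → Connected F u v → Connected F v u
  Connected-sym = reverse (λ {u} {v} → F-sym u v)

  separates-sym : ∀ {a b} → Separates F a b → Separates F b a
  separates-sym (cover , apart) = flip-cover , λ b~a → apart (Connected-sym b~a)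
    where
      flip-cover : ∀ u → Connected F _ u ⊎ Connected F _ u
      flip-cover u with cover u
      ... | inj₁ a~u = inj₂ a~u
      ... | inj₂ b~u = inj₁ b~u

  Connected-invariant : (inv : Vertex m n → Bool) → (∀ {u v} → T (F u v) → inv u ≡ inv v) →
                        ∀ {u v} → Connected F u v → inv u ≡ inv v
  Connected-invariant inv edge-inv = fold (λ u v → inv u ≡ inv v) (λ e rest → trans (edge-inv e) rest) refl

  separates-by-invariant : (inv : Vertex m n → Bool) → (∀ {u v} → T (F u v) → inv u ≡ inv v) →
                           (∀ u v → inv u ≡ inv v → Connected F u v) →
                           ∀ {a b} → inv a ≢ inv b → Separates F a b
  separates-by-invariant inv edge-inv fibre-connected {a} {b} a≢b = cover , apart
    where
      cover : ∀ u → Connected F a u ⊎ Connected F b u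
      cover u with inv a | inv b | inv u | fibre-connected a u | fibre-connected b u
      ... | true  | true  | _     | _    | _    = ⊥-elim (a≢b refl)
      ... | false | false | _     | _    | _    = ⊥-elim (a≢b refl)
      ... | true  | false | true  | a~u  | _    = inj₁ (a~u refl)
      ... | true  | false | false | _    | b~u  = inj₂ (b~u refl)
      ... | false | true  | false | a~u  | _    = inj₁ (a~u refl)
      ... | false | true  | true  | _    | b~u  = inj₂ (b~u refl)
      apart : ¬ Connected F a b
      apart a~b = a≢b (Connected-invariant inv edge-inv a~b)

separating-sym : ∀ {m n a b} → SeparatingTwoFactor m n a b → SeparatingTwoFactor m n b a
separating-sym (F , isTwoFactor , separates) =
  F , isTwoFactor , separates-sym (IsTwoFactor.symmetric isTwoFactor) separates

record Automorphism (m n : ℕ) : Set where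
  field
    to from  : Vertex m n → Vertex m n
    to-from  : ∀ u → to (from u) ≡ u
    from-to  : ∀ u → from (to u) ≡ u
    to-adj   : ∀ {u v} → Adj m n u v → Adj m n (to u) (to v)

module _ {m n : ℕ} (φ : Automorphism m n) where
  open Automorphism φ

  separating-transport : ∀ {a b} → SeparatingTwoFactor m n a b → SeparatingTwoFactor m n (to a) (to b)
  separating-transport {a} {b} (F , isTwoFactor , cover , apart) = Fφ , isTwoFactorφ , coverφ , apartφ
    where
      open IsTwoFactor isTwoFactor

      Fφ : Vertex m n → Vertex m n → Bool
      Fφ u v = F (from u) (from v)

      F⇒Fφ : ∀ {u v} → T (F u v) → T (Fφ (to u) (to v))
      F⇒Fφ {u} {v} = subst₂ (λ x y → T (F x y)) (sym (from-to u)) (sym (from-to v))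

      to-injective : ∀ {u v} → to u ≡ to v → u ≡ v
      to-injective {u} {v} e = trans (sym (from-to u)) (trans (cong from e) (from-to v))

      valency2φ : ∀ u → Σ (Vertex m n) λ v → Σ (Vertex m n) λ w →
                    v ≢ w × T (Fφ u v) × T (Fφ u w) × (∀ x → T (Fφ u x) → x ≡ v ⊎ x ≡ w)
      valency2φ u with valency2 (from u)
      ... | v , w , v≢w , uv , uw , only =
        to v , to w , (λ e → v≢w (to-injective e)) , from-u uv , from-u uw ,
        λ x ux → map-only x (only (from x) ux)
        where
          from-u : ∀ {y} → T (F (from u) y) → T (Fφ u (to y))
          from-u {y} = subst (λ z → T (F (from u) z)) (sym (from-to y))
          map-only : ∀ x → from x ≡ v ⊎ from x ≡ w → x ≡ to v ⊎ x ≡ to w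
          map-only x (inj₁ e) = inj₁ (trans (sym (to-from x)) (cong to e))
          map-only x (inj₂ e) = inj₂ (trans (sym (to-from x)) (cong to e))

      isTwoFactorφ : IsTwoFactor m n Fφ
      isTwoFactorφ = record
        { symmetric = λ u v → symmetric (from u) (from v)
        ; edges     = λ u v uv → subst₂ (Adj m n) (to-from u) (to-from v) (to-adj (edges (from u) (from v) uv))
        ; valency2  = valency2φ
        }

      push : ∀ {u v} → Connected F u v → Connected Fφ (to u) (to v)
      push = gmap to F⇒Fφ

      coverφ : ∀ u → Connected Fφ (to a) u ⊎ Connected Fφ (to b) u
      coverφ u with cover (from u)
      ... | inj₁ a~u = inj₁ (subst (Connected Fφ (to a)) (to-from u) (push a~u))
      ... | inj₂ b~u = inj₂ (subst (Connected Fφ (to b)) (to-from u) (push b~u))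

      apartφ : ¬ Connected Fφ (to a) (to b)
      apartφ a~b = apart (subst₂ (Connected F) (from-to a) (from-to b) (gmap from (λ uv → uv) a~b))

module Cycle (n₀ : ℕ) where
  open ≡-Reasoning

  next : ℕ → ℕ
  next r = if r ≡ᵇ n₀ then 0 else suc r

  prev : ℕ → ℕ
  prev zero    = n₀
  prev (suc r) = r

  next-last : next n₀ ≡ 0
  next-last rewrite ≡ᵇ-refl n₀ = refl

  next-< : ∀ {r} → r < n₀ → next r ≡ suc r
  next-< {r} r<n₀ rewrite ≡ᵇ-false {r} {n₀} (<⇒≢ r<n₀) = refl

  next-cases : ∀ r → (r ≡ n₀ × next r ≡ 0) ⊎ next r ≡ suc r
  next-cases r with r ≡ᵇ n₀ in e
  ... | true  = inj₁ (≡ᵇ⇒≡ r n₀ (subst T (sym e) _) , refl)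
  ... | false = inj₂ refl

  below-or-last : ∀ {r} → r < suc n₀ → r < n₀ ⊎ r ≡ n₀
  below-or-last (s≤s r≤n₀) = m≤n⇒m<n∨m≡n r≤n₀

  next-bound : ∀ {r} → r < suc n₀ → next r < suc n₀
  next-bound {r} r<n with below-or-last r<n
  ... | inj₁ r<n₀ rewrite next-< r<n₀ = s≤s r<n₀
  ... | inj₂ refl rewrite next-last = s≤s z≤n

  prev-bound : ∀ {r} → r < suc n₀ → prev r < suc n₀
  prev-bound {zero}  _       = ≤-refl
  prev-bound {suc r} 1+r<n = <-trans (n<1+n r) 1+r<n

  prev-next : ∀ {r} → r < suc n₀ → prev (next r) ≡ r
  prev-next {r} r<n with below-or-last r<n
  ... | inj₁ r<n₀ rewrite next-< r<n₀ = refl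
  ... | inj₂ refl rewrite next-last = refl

  next-prev : ∀ {r} → r < suc n₀ → next (prev r) ≡ r
  next-prev {zero}  _           = next-last
  next-prev {suc r} (s≤s r<n₀) = next-< r<n₀

  next≢prev : 2 ≤ n₀ → ∀ {r} → r < suc n₀ → next r ≢ prev r
  next≢prev 2≤n₀ {zero} _ 1≡n₀ rewrite next-< (≤-trans (s≤s z≤n) 2≤n₀) = <-irrefl 1≡n₀ 2≤n₀
  next≢prev 2≤n₀ {suc r} _ e with next-cases (suc r)
  ... | inj₁ (1+r≡n₀ , next≡0) = <-irrefl (sym (trans (sym e) next≡0))
                                    (≤-trans (s≤s z≤n) (≤-pred (subst (2 ≤_) (sym 1+r≡n₀) 2≤n₀)))
  ... | inj₂ next≡2+r          = <-irrefl (trans (sym e) next≡2+r) (s≤s (n≤1+n r))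

  next-next≢ : 2 ≤ n₀ → ∀ {r} → r < suc n₀ → next (next r) ≢ r
  next-next≢ 2≤n₀ r<n e = next≢prev 2≤n₀ r<n (trans (sym (prev-next (next-bound r<n))) (cong prev e))

  CycSucc⇒next : ∀ {j j'} → CycSucc (suc n₀) j j' → toℕ j' ≡ next (toℕ j)
  CycSucc⇒next (inj₂ (j≡n₀ , j'≡0)) = trans j'≡0 (sym (trans (cong next j≡n₀) next-last))
  CycSucc⇒next {j} {j'} (inj₁ j'≡1+j) with next-cases (toℕ j)
  ... | inj₁ (j≡n₀ , _) = ⊥-elim (<-irrefl refl (subst (_< suc n₀) (trans j'≡1+j (cong suc j≡n₀)) (toℕ<n j')))
  ... | inj₂ next≡1+j   = trans j'≡1+j (sym next≡1+j)

  next⇒CycSucc : ∀ {j j'} → toℕ j' ≡ next (toℕ j) → CycSucc (suc n₀) j j'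
  next⇒CycSucc {j} e with next-cases (toℕ j)
  ... | inj₁ (j≡n₀ , next≡0) = inj₂ (j≡n₀ , trans e next≡0)
  ... | inj₂ next≡1+j        = inj₁ (trans e next≡1+j)

  rotate unrotate : Fin (suc n₀) → Fin (suc n₀)
  rotate   j = fromℕ< (next-bound (toℕ<n j))
  unrotate j = fromℕ< (prev-bound (toℕ<n j))

  toℕ-rotate : ∀ j → toℕ (rotate j) ≡ next (toℕ j)
  toℕ-rotate j = toℕ-fromℕ< _

  toℕ-unrotate : ∀ j → toℕ (unrotate j) ≡ prev (toℕ j)
  toℕ-unrotate j = toℕ-fromℕ< _

  rotate-unrotate : ∀ j → rotate (unrotate j) ≡ j
  rotate-unrotate j = toℕ-injective (begin
    toℕ (rotate (unrotate j)) ≡⟨ toℕ-rotate (unrotate j) ⟩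
    next (toℕ (unrotate j))   ≡⟨ cong next (toℕ-unrotate j) ⟩
    next (prev (toℕ j))       ≡⟨ next-prev (toℕ<n j) ⟩
    toℕ j                     ∎)

  unrotate-rotate : ∀ j → unrotate (rotate j) ≡ j
  unrotate-rotate j = toℕ-injective (begin
    toℕ (unrotate (rotate j)) ≡⟨ toℕ-unrotate (rotate j) ⟩
    prev (toℕ (rotate j))     ≡⟨ cong prev (toℕ-rotate j) ⟩
    prev (next (toℕ j))       ≡⟨ prev-next (toℕ<n j) ⟩
    toℕ j                     ∎)

  unrotate-injective : ∀ {j j'} → unrotate j ≡ unrotate j' → j ≡ j'
  unrotate-injective {j} {j'} e = trans (sym (rotate-unrotate j)) (trans (cong rotate e) (rotate-unrotate j'))

  rotate²≢ : 2 ≤ n₀ → ∀ j → j ≢ rotate (rotate j)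
  rotate²≢ 2≤n₀ j e = next-next≢ 2≤n₀ (toℕ<n j) (sym (begin
    toℕ j                     ≡⟨ cong toℕ e ⟩
    toℕ (rotate (rotate j))   ≡⟨ toℕ-rotate (rotate j) ⟩
    next (toℕ (rotate j))     ≡⟨ cong next (toℕ-rotate j) ⟩
    next (next (toℕ j))       ∎))

  rotate-CycSucc : ∀ {j j'} → CycSucc (suc n₀) j j' → CycSucc (suc n₀) (rotate j) (rotate j')
  rotate-CycSucc {j} {j'} j→j' = next⇒CycSucc (begin
    toℕ (rotate j')      ≡⟨ toℕ-rotate j' ⟩
    next (toℕ j')        ≡⟨ cong next (CycSucc⇒next j→j') ⟩
    next (next (toℕ j))  ≡⟨ cong next (sym (toℕ-rotate j)) ⟩
    next (toℕ (rotate j)) ∎)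

  rowRotation : ∀ m → Automorphism m (suc n₀)
  rowRotation m = record
    { to      = λ (i , j) → i , rotate j
    ; from    = λ (i , j) → i , unrotate j
    ; to-from = λ (i , j) → cong (i ,_) (rotate-unrotate j)
    ; from-to = λ (i , j) → cong (i ,_) (unrotate-rotate j)
    ; to-adj  = λ { (inj₁ s) → inj₁ (rotate-step s) ; (inj₂ s) → inj₂ (rotate-step s) }
    }
    where
      rotate-step : ∀ {u v} → Step m (suc n₀) u v → Step m (suc n₀) (proj₁ u , rotate (proj₂ u)) (proj₁ v , rotate (proj₂ v))
      rotate-step (inj₁ (i≡i' , j→j')) = inj₁ (i≡i' , rotate-CycSucc j→j')
      rotate-step (inj₂ (i→i' , j≡j')) = inj₂ (i→i' , cong rotate j≡j')

data Dir : Set where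
  north south east west : Dir

atDir : Bool → Bool → Bool → Bool → Dir → Bool
atDir a _ _ _ north = a
atDir _ b _ _ south = b
atDir _ _ c _ east  = c
atDir _ _ _ d west  = d

directions : List Dir
directions = north ∷ south ∷ east ∷ west ∷ []

any-direction : ∀ (P : Dir → Bool) d → T (P d) → T (any P directions)
any-direction P north h = any⁺ {xs = directions} P (here h)
any-direction P south h = any⁺ {xs = directions} P (there (here h))
any-direction P east  h = any⁺ {xs = directions} P (there (there (here h)))
any-direction P west  h = any⁺ {xs = directions} P (there (there (there (here h))))

data ExactlyTwo : Bool → Bool → Bool → Bool → Set where
  ns : ExactlyTwo true  true  false false
  ne : ExactlyTwo true  false true  false
  nw : ExactlyTwo true  false false true
  se : ExactlyTwo false true  true  false
  sw : ExactlyTwo false true  false true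
  ew : ExactlyTwo false false true  true

exactlyTwo? : ∀ a b c d → Dec (ExactlyTwo a b c d)
exactlyTwo? true  true  true  true  = no λ ()
exactlyTwo? true  true  true  false = no λ ()
exactlyTwo? true  true  false true  = no λ ()
exactlyTwo? true  true  false false = yes ns
exactlyTwo? true  false true  true  = no λ ()
exactlyTwo? true  false true  false = yes ne
exactlyTwo? true  false false true  = yes nw
exactlyTwo? true  false false false = no λ ()
exactlyTwo? false true  true  true  = no λ ()
exactlyTwo? false true  true  false = yes se
exactlyTwo? false true  false true  = yes sw
exactlyTwo? false true  false false = no λ ()
exactlyTwo? false false true  true  = yes ew
exactlyTwo? false false true  false = no λ ()
exactlyTwo? false false false true  = no λ ()
exactlyTwo? false false false false = no λ ()

exactlyTwo : ∀ {a b c d} → True (exactlyTwo? a b c d) → ExactlyTwo a b c d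
exactlyTwo = toWitness

ExactlyTwo-cong : ∀ {a b c d a' b' c' d'} → a ≡ a' → b ≡ b' → c ≡ c' → d ≡ d' →
                  ExactlyTwo a b c d → ExactlyTwo a' b' c' d'
ExactlyTwo-cong refl refl refl refl two = two

ExactlyTwo-swapEW : ∀ {a b c d} → ExactlyTwo a b c d → ExactlyTwo a b d c
ExactlyTwo-swapEW ns = ns
ExactlyTwo-swapEW ne = nw
ExactlyTwo-swapEW nw = ne
ExactlyTwo-swapEW se = sw
ExactlyTwo-swapEW sw = se
ExactlyTwo-swapEW ew = ew

record TwoDirections (P : Dir → Bool) : Set where
  field
    d₁ d₂ : Dir
    d₁≢d₂ : d₁ ≢ d₂
    P-d₁  : T (P d₁)
    P-d₂  : T (P d₂)
    only  : ∀ d → T (P d) → d ≡ d₁ ⊎ d ≡ d₂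

twoDirections : ∀ {a b c d} → ExactlyTwo a b c d → TwoDirections (atDir a b c d)
twoDirections ns = record { d₁ = north ; d₂ = south ; d₁≢d₂ = λ () ; P-d₁ = _ ; P-d₂ = _
                          ; only = λ { north _ → inj₁ refl ; south _ → inj₂ refl ; east () ; west () } }
twoDirections ne = record { d₁ = north ; d₂ = east ; d₁≢d₂ = λ () ; P-d₁ = _ ; P-d₂ = _
                          ; only = λ { north _ → inj₁ refl ; east _ → inj₂ refl ; south () ; west () } }
twoDirections nw = record { d₁ = north ; d₂ = west ; d₁≢d₂ = λ () ; P-d₁ = _ ; P-d₂ = _
                          ; only = λ { north _ → inj₁ refl ; west _ → inj₂ refl ; south () ; east () } }
twoDirections se = record { d₁ = south ; d₂ = east ; d₁≢d₂ = λ () ; P-d₁ = _ ; P-d₂ = _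
                          ; only = λ { south _ → inj₁ refl ; east _ → inj₂ refl ; north () ; west () } }
twoDirections sw = record { d₁ = south ; d₂ = west ; d₁≢d₂ = λ () ; P-d₁ = _ ; P-d₂ = _
                          ; only = λ { south _ → inj₁ refl ; west _ → inj₂ refl ; north () ; east () } }
twoDirections ew = record { d₁ = east ; d₂ = west ; d₁≢d₂ = λ () ; P-d₁ = _ ; P-d₂ = _
                          ; only = λ { east _ → inj₁ refl ; west _ → inj₂ refl ; north () ; south () } }

-- (c , r) stands for u_{c,r}: column c of the path, row r of the cycle.
Point : Set
Point = ℕ × ℕ

_≟ₚ_ : DecidableEquality Point
_≟ₚ_ = ≡-dec _≟_ _≟_

-- north? c r and east? c r tell whether u_{c,r} is joined to u_{c,r+1} and to u_{c+1,r};
-- east edges leaving the last column are ignored.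
module LocalCode (m n₀ : ℕ) (2≤n₀ : 2 ≤ n₀) (north? east? : ℕ → ℕ → Bool) where
  open Cycle n₀

  InRange : Point → Set
  InRange (c , r) = c < m × r < suc n₀

  west? : ℕ → ℕ → Bool
  west? zero    _ = false
  west? (suc c) r = east? c r

  has : Dir → Point → Bool
  has d (c , r) = atDir (north? c r) (north? c (prev r)) (east? c r ∧ (suc c <ᵇ m)) (west? c r) d

  target : Dir → Point → Point
  target north (c , r) = c , next r
  target south (c , r) = c , prev r
  target east  (c , r) = suc c , r
  target west  (c , r) = pred c , r

  target-in-range : ∀ d {p} → InRange p → T (has d p) → InRange (target d p)
  target-in-range north         (c<m , r<n) _ = c<m , next-bound r<n
  target-in-range south         (c<m , r<n) _ = c<m , prev-bound r<n
  target-in-range east  {c , _} (_   , r<n) h = <ᵇ⇒< (suc c) m (proj₂ (Equivalence.to T-∧ h)) , r<n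
  target-in-range west  {suc c , _} (1+c<m , r<n) _ = <-trans (n<1+n c) 1+c<m , r<n

  target-injective : ∀ {d d' c r} → r < suc n₀ → T (has d (c , r)) → T (has d' (c , r)) →
                     target d (c , r) ≡ target d' (c , r) → d ≡ d'
  target-injective {north} {north} _ _ _ _ = refl
  target-injective {south} {south} _ _ _ _ = refl
  target-injective {east}  {east}  _ _ _ _ = refl
  target-injective {west}  {west}  _ _ _ _ = refl
  target-injective {north} {south} r<n _ _ e = ⊥-elim (next≢prev 2≤n₀ r<n (cong proj₂ e))
  target-injective {south} {north} r<n _ _ e = ⊥-elim (next≢prev 2≤n₀ r<n (sym (cong proj₂ e)))
  target-injective {north} {east} {c} _ _ _ e = ⊥-elim (<-irrefl (cong proj₁ e) (n<1+n c))
  target-injective {south} {east} {c} _ _ _ e = ⊥-elim (<-irrefl (cong proj₁ e) (n<1+n c))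
  target-injective {east} {north} {c} _ _ _ e = ⊥-elim (<-irrefl (sym (cong proj₁ e)) (n<1+n c))
  target-injective {east} {south} {c} _ _ _ e = ⊥-elim (<-irrefl (sym (cong proj₁ e)) (n<1+n c))
  target-injective {north} {west} {suc c} _ _ _ e = ⊥-elim (<-irrefl (sym (cong proj₁ e)) (n<1+n c))
  target-injective {south} {west} {suc c} _ _ _ e = ⊥-elim (<-irrefl (sym (cong proj₁ e)) (n<1+n c))
  target-injective {west} {north} {suc c} _ _ _ e = ⊥-elim (<-irrefl (cong proj₁ e) (n<1+n c))
  target-injective {west} {south} {suc c} _ _ _ e = ⊥-elim (<-irrefl (cong proj₁ e) (n<1+n c))
  target-injective {east} {west} {suc c} _ _ _ e = ⊥-elim (<-irrefl (sym (cong proj₁ e)) (s≤s (n≤1+n c)))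
  target-injective {west} {east} {suc c} _ _ _ e = ⊥-elim (<-irrefl (cong proj₁ e) (s≤s (n≤1+n c)))

  V : Set
  V = Vertex m (suc n₀)

  pos : V → Point
  pos (i , j) = toℕ i , toℕ j

  pos-injective : ∀ {u v} → pos u ≡ pos v → u ≡ v
  pos-injective e = cong₂ _,_ (toℕ-injective (cong proj₁ e)) (toℕ-injective (cong proj₂ e))

  pos-in-range : ∀ u → InRange (pos u)
  pos-in-range (i , j) = toℕ<n i , toℕ<n j

  vertex : ∀ p → InRange p → V
  vertex _ (c<m , r<n) = fromℕ< c<m , fromℕ< r<n

  pos-vertex : ∀ p (p∈ : InRange p) → pos (vertex p p∈) ≡ p
  pos-vertex _ (c<m , r<n) = cong₂ _,_ (toℕ-fromℕ< c<m) (toℕ-fromℕ< r<n)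

  Link : V → V → Dir → Bool
  Link u v d = has d (pos u) ∧ ⌊ pos v ≟ₚ target d (pos u) ⌋

  F : V → V → Bool
  F u v = any (Link u v) directions

  F-intro : ∀ {u v} d → T (has d (pos u)) → pos v ≡ target d (pos u) → T (F u v)
  F-intro {u} {v} d h e =
    any-direction (Link u v) d (Equivalence.from T-∧ (h , fromWitness {a? = pos v ≟ₚ target d (pos u)} e))

  F-elim : ∀ {u v} → T (F u v) → Σ Dir λ d → T (has d (pos u)) × pos v ≡ target d (pos u)
  F-elim {u} {v} h with satisfied (any⁻ (Link u v) directions h)
  ... | d , link with Equivalence.to T-∧ link
  ... | has-d , at-target = d , has-d , toWitness at-target

  data Move : Point → Point → Set where
    move : ∀ d {p} → InRange p → T (has d p) → Move p (target d p)

  infix 4 _~_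
  _~_ : Point → Point → Set
  _~_ = Star Move

  Move-sym : ∀ {p q} → Move p q → Move q p
  Move-sym (move north {c , r} (c<m , r<n) h) =
    subst (Move _) (cong (c ,_) (prev-next r<n))
      (move south (c<m , next-bound r<n) (subst (λ z → T (north? c z)) (sym (prev-next r<n)) h))
  Move-sym (move south {c , r} (c<m , r<n) h) =
    subst (Move _) (cong (c ,_) (next-prev r<n)) (move north (c<m , prev-bound r<n) h)
  Move-sym (move east {c , r} p∈ h) =
    move west (target-in-range east p∈ h) (proj₁ (Equivalence.to T-∧ h))
  Move-sym (move west {suc c , r} (1+c<m , r<n) h) =
    move east (<-trans (n<1+n c) 1+c<m , r<n) (Equivalence.from T-∧ (h , <⇒<ᵇ 1+c<m))

  ~-sym : ∀ {p q} → p ~ q → q ~ p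
  ~-sym = reverse Move-sym

  north-step : ∀ {c r} → c < m → r < suc n₀ → T (north? c r) → (c , r) ~ (c , next r)
  north-step c<m r<n h = move north (c<m , r<n) h ◅ ε

  east-step : ∀ {c r} → suc c < m → r < suc n₀ → T (east? c r) → (c , r) ~ (suc c , r)
  east-step {c} 1+c<m r<n h = move east (<-trans (n<1+n c) 1+c<m , r<n) (Equivalence.from T-∧ (h , <⇒<ᵇ 1+c<m)) ◅ ε

  column-walk : ∀ {c a} → c < m → ∀ b → a ≤ b → b < suc n₀ →
                (∀ r → a ≤ r → r < b → T (north? c r)) → (c , a) ~ (c , b)
  column-walk c<m zero    z≤n  _ _ = ε
  column-walk {c} c<m (suc b) a≤1+b 1+b<n present with m≤n⇒m<n∨m≡n a≤1+b
  ... | inj₂ refl      = ε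
  ... | inj₁ (s≤s a≤b) =
    column-walk c<m b a≤b b<n (λ r a≤r r<b → present r a≤r (m<n⇒m<1+n r<b)) ◅◅
    subst (λ z → (c , b) ~ (c , z)) (next-< (≤-pred 1+b<n)) (north-step c<m b<n (present b a≤b ≤-refl))
    where b<n = <-trans (n<1+n b) 1+b<n

  Move⇒F : ∀ {p q u v} → Move p q → pos u ≡ p → pos v ≡ q → T (F u v)
  Move⇒F (move d _ h) refl at-target = F-intro d h at-target

  F⇒Move : ∀ {u v} → T (F u v) → Move (pos u) (pos v)
  F⇒Move {u} h with F-elim h
  ... | d , has-d , at-target = subst (Move (pos u)) (sym at-target) (move d (pos-in-range u) has-d)

  F-sym : ∀ u v → T (F u v) → T (F v u)
  F-sym u v h = Move⇒F (Move-sym (F⇒Move h)) refl refl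

  connected : ∀ {p q} → p ~ q → ∀ {u v} → pos u ≡ p → pos v ≡ q → Connected F u v
  connected ε pu≡p pv≡p = subst (Connected F _) (pos-injective (trans pu≡p (sym pv≡p))) ε
  connected (move d p∈ h ◅ rest) pu≡p pv≡q =
    Move⇒F (move d p∈ h) pu≡p (pos-vertex _ q∈) ◅ connected rest (pos-vertex _ q∈) pv≡q
    where q∈ = target-in-range d p∈ h

  Move⇒Adj : ∀ {p q u v} → Move p q → pos u ≡ p → pos v ≡ q → Adj m (suc n₀) u v
  Move⇒Adj {u = i , j} {i' , j'} (move north _ _) refl e =
    inj₁ (inj₁ (toℕ-injective (sym (cong proj₁ e)) , next⇒CycSucc (cong proj₂ e)))
  Move⇒Adj {u = i , j} {i' , j'} (move south (_ , r<n) _) refl e =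
    inj₂ (inj₁ (toℕ-injective (cong proj₁ e) , next⇒CycSucc (trans (sym (next-prev r<n)) (cong next (sym (cong proj₂ e))))))
  Move⇒Adj {u = i , j} {i' , j'} (move east _ _) refl e =
    inj₁ (inj₂ (cong proj₁ e , toℕ-injective (sym (cong proj₂ e))))
  Move⇒Adj (move west {suc c , _} _ _) pu e =
    inj₂ (inj₂ (trans (cong proj₁ pu) (cong suc (sym (cong proj₁ e))) ,
                toℕ-injective (trans (cong proj₂ e) (sym (cong proj₂ pu)))))

  Move-invariant : (inv : Point → Bool) →
                   (∀ {c r} → c < m → r < suc n₀ → T (north? c r) → inv (c , r) ≡ inv (c , next r)) →
                   (∀ {c r} → T (east? c r) → inv (c , r) ≡ inv (suc c , r)) →
                   ∀ {p q} → Move p q → inv p ≡ inv q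
  Move-invariant inv inv-north inv-east (move north (c<m , r<n) h) = inv-north c<m r<n h
  Move-invariant inv inv-north inv-east (move south {c , r} (c<m , r<n) h) =
    sym (trans (inv-north c<m (prev-bound r<n) h) (cong (λ z → inv (c , z)) (next-prev r<n)))
  Move-invariant inv inv-north inv-east (move east {c , r} _ h) = inv-east (proj₁ (Equivalence.to T-∧ h))
  Move-invariant inv inv-north inv-east (move west {suc c , r} _ h) = sym (inv-east h)

  module _ (degree : ∀ p → InRange p → ExactlyTwo (has north p) (has south p) (has east p) (has west p)) where

    valency2 : ∀ u → Σ V λ v → Σ V λ w →
                 v ≢ w × T (F u v) × T (F u w) × (∀ x → T (F u x) → x ≡ v ⊎ x ≡ w)
    valency2 u = neighbour d₁ P-d₁ , neighbour d₂ P-d₂ , distinct , F-neighbour d₁ P-d₁ , F-neighbour d₂ P-d₂ , only-neighbours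
      where
        open TwoDirections (twoDirections (degree (pos u) (pos-in-range u)))

        neighbour : ∀ d → T (has d (pos u)) → V
        neighbour d h = vertex (target d (pos u)) (target-in-range d (pos-in-range u) h)

        pos-neighbour : ∀ d h → pos (neighbour d h) ≡ target d (pos u)
        pos-neighbour d h = pos-vertex _ (target-in-range d (pos-in-range u) h)

        F-neighbour : ∀ d h → T (F u (neighbour d h))
        F-neighbour d h = F-intro d h (pos-neighbour d h)

        distinct : neighbour d₁ P-d₁ ≢ neighbour d₂ P-d₂
        distinct e = d₁≢d₂ (target-injective (proj₂ (pos-in-range u)) P-d₁ P-d₂
          (trans (sym (pos-neighbour d₁ P-d₁)) (trans (cong pos e) (pos-neighbour d₂ P-d₂))))

        only-neighbours : ∀ x → T (F u x) → x ≡ neighbour d₁ P-d₁ ⊎ x ≡ neighbour d₂ P-d₂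
        only-neighbours x ux with F-elim ux
        ... | d , has-d , at-target with only d has-d
        ... | inj₁ refl = inj₁ (pos-injective (trans at-target (sym (pos-neighbour d₁ P-d₁))))
        ... | inj₂ refl = inj₂ (pos-injective (trans at-target (sym (pos-neighbour d₂ P-d₂))))

    isTwoFactor : IsTwoFactor m (suc n₀) F
    isTwoFactor = record
      { symmetric = F-sym
      ; edges     = λ u v uv → Move⇒Adj (F⇒Move uv) refl refl
      ; valency2  = valency2
      }

  separates-by-hubs : (inv : Point → Bool) → (∀ {p q} → Move p q → inv p ≡ inv q) →
                      (hub : Bool → Point) → (∀ p → InRange p → p ~ hub (inv p)) →
                      ∀ {a b} → inv (pos a) ≢ inv (pos b) → Separates F a b
  separates-by-hubs inv inv-move hub to-hub =
    separates-by-invariant F-sym (λ u → inv (pos u)) (λ uv → inv-move (F⇒Move uv)) fibre-connected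
    where
      fibre-connected : ∀ u v → inv (pos u) ≡ inv (pos v) → Connected F u v
      fibre-connected u v same = connected
        (to-hub (pos u) (pos-in-range u) ◅◅ subst (λ b → hub b ~ pos v) (sym same) (~-sym (to-hub (pos v) (pos-in-range v))))
        refl refl

gap : ℕ → ℕ
gap zero          = 3
gap (suc zero)    = 2
gap (suc (suc t)) = gap t

gap-alternates : ∀ t → (gap t ≡ 2 × gap (suc t) ≡ 3) ⊎ (gap t ≡ 3 × gap (suc t) ≡ 2)
gap-alternates zero          = inj₂ (refl , refl)
gap-alternates (suc zero)    = inj₁ (refl , refl)
gap-alternates (suc (suc t)) = gap-alternates t

gap≤3 : ∀ t → gap t ≤ 3
gap≤3 t with gap-alternates t
... | inj₁ (gap≡2 , _) = ≤-trans (≤-reflexive gap≡2) (n≤1+n 2)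
... | inj₂ (gap≡3 , _) = ≤-reflexive gap≡3

-- Ring 0 is the pair of core columns: the rungs at rows 0, 1 close the square and those at rows
-- 2 and n − 1 close the ladder on the remaining rows.
module Rings (n' : ℕ) where
  open Cycle (4 + n')

  isLast : ℕ → Bool
  isLast r = r ≡ᵇ 4 + n'

  innerCut? : ℕ → ℕ → Bool
  innerCut? zero    r = (r ≡ᵇ 1) ∨ isLast r
  innerCut? (suc t) r = r ≡ᵇ gap (suc t)

  ringNorth? : ℕ → Bool → ℕ → Bool
  ringNorth? t outer r = not (innerCut? t r ∨ ((r ≡ᵇ gap (suc t)) ∧ outer))

  rung? : ℕ → ℕ → Bool
  rung? zero    r = (r ≤ᵇ 2) ∨ isLast r
  rung? (suc t) r = (r ≡ᵇ gap (suc t)) ∨ (r ≡ᵇ suc (gap (suc t)))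

  isLast-< : ∀ {r} → r < 4 + n' → isLast r ≡ false
  isLast-< r<last = ≡ᵇ-false (<⇒≢ r<last)

  core-degree : ∀ outer r → r < 5 + n' →
    ExactlyTwo (ringNorth? 0 outer r) (ringNorth? 0 outer (prev r)) (rung? 0 r) (rung? 1 r ∧ outer)
  core-degree outer zero _ rewrite ≡ᵇ-refl (4 + n') = exactlyTwo _
  core-degree outer 1     _ = exactlyTwo _
  core-degree true  2     _ = exactlyTwo _
  core-degree false 2     _ = exactlyTwo _
  core-degree true  3     _ = exactlyTwo _
  core-degree false 3     _ = exactlyTwo _
  core-degree outer (suc (suc (suc (suc s)))) (s≤s 4+s<last) rewrite isLast-< {3 + s} 4+s<last with isLast (4 + s)
  ... | true  = exactlyTwo _
  ... | false = exactlyTwo _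

  ring-degree : ∀ t outer r → r < 5 + n' →
    ExactlyTwo (ringNorth? t outer r) (ringNorth? t outer (prev r)) (rung? t r) (rung? (suc t) r ∧ outer)
  ring-degree zero = core-degree
  ring-degree (suc t) outer r _ with gap (suc t) | gap (suc (suc t)) | gap-alternates (suc t)
  ring-degree (suc t) outer 0 _ | _ | _ | inj₁ (refl , refl) = exactlyTwo _
  ring-degree (suc t) outer 1 _ | _ | _ | inj₁ (refl , refl) = exactlyTwo _
  ring-degree (suc t) outer 2 _ | _ | _ | inj₁ (refl , refl) = exactlyTwo _
  ring-degree (suc t) true  3 _ | _ | _ | inj₁ (refl , refl) = exactlyTwo _
  ring-degree (suc t) false 3 _ | _ | _ | inj₁ (refl , refl) = exactlyTwo _
  ring-degree (suc t) true  4 _ | _ | _ | inj₁ (refl , refl) = exactlyTwo _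
  ring-degree (suc t) false 4 _ | _ | _ | inj₁ (refl , refl) = exactlyTwo _
  ring-degree (suc t) outer (suc (suc (suc (suc (suc s))))) _ | _ | _ | inj₁ (refl , refl) = exactlyTwo _
  ring-degree (suc t) outer 0 _ | _ | _ | inj₂ (refl , refl) = exactlyTwo _
  ring-degree (suc t) outer 1 _ | _ | _ | inj₂ (refl , refl) = exactlyTwo _
  ring-degree (suc t) true  2 _ | _ | _ | inj₂ (refl , refl) = exactlyTwo _
  ring-degree (suc t) false 2 _ | _ | _ | inj₂ (refl , refl) = exactlyTwo _
  ring-degree (suc t) true  3 _ | _ | _ | inj₂ (refl , refl) = exactlyTwo _
  ring-degree (suc t) false 3 _ | _ | _ | inj₂ (refl , refl) = exactlyTwo _
  ring-degree (suc t) outer 4 _ | _ | _ | inj₂ (refl , refl) = exactlyTwo _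
  ring-degree (suc t) outer (suc (suc (suc (suc (suc s))))) _ | _ | _ | inj₂ (refl , refl) = exactlyTwo _

  off-gap : ∀ {i} t → i ≢ 2 → i ≢ 3 → (i ≡ᵇ gap t) ≡ false
  off-gap t i≢2 i≢3 with gap-alternates t
  ... | inj₁ (gap≡2 , _) = ≡ᵇ-false (λ i≡gap → i≢2 (trans i≡gap gap≡2))
  ... | inj₂ (gap≡3 , _) = ≡ᵇ-false (λ i≡gap → i≢3 (trans i≡gap gap≡3))

  ringNorth-off-gaps : ∀ t outer {i} → i ≢ 2 → i ≢ 3 → T (ringNorth? (suc t) outer i)
  ringNorth-off-gaps t outer i≢2 i≢3 rewrite off-gap (suc t) i≢2 i≢3 | off-gap (suc (suc t)) i≢2 i≢3 = _

  ringNorth-outer-gap : ∀ t → T (ringNorth? (suc t) false (gap (suc (suc t))))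
  ringNorth-outer-gap t with gap (suc t) | gap (suc (suc t)) | gap-alternates (suc t)
  ... | _ | _ | inj₁ (refl , refl) = _
  ... | _ | _ | inj₂ (refl , refl) = _

  ringNorth-core-middle : ∀ outer {i} → 3 ≤ i → i < 4 + n' → T (ringNorth? 0 outer i)
  ringNorth-core-middle outer {suc (suc (suc s))} (s≤s (s≤s (s≤s _))) i<last rewrite isLast-< i<last = _

  rung-at-gap : ∀ t → T (rung? (suc t) (gap (suc t)))
  rung-at-gap t = Equivalence.from T-∨ (inj₁ (≡⇒≡ᵇ (gap (suc t)) _ refl))

  rung-above-gap : ∀ t → T (rung? (suc t) (suc (gap (suc t))))
  rung-above-gap t = Equivalence.from (T-∨ {suc (gap (suc t)) ≡ᵇ gap (suc t)}) (inj₂ (≡⇒≡ᵇ (suc (gap (suc t))) _ refl))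

  rung-three : ∀ t → T (rung? (suc t) 3)
  rung-three t with gap (suc t) | gap-alternates (suc t)
  ... | _ | inj₁ (refl , _) = _
  ... | _ | inj₂ (refl , _) = _

  rung-off-square : ∀ t {r} → T (rung? (suc t) r) → 2 ≤ r
  rung-off-square t {r} h with gap (suc t) | gap-alternates (suc t) | r
  ... | _ | inj₁ (refl , _) | suc (suc _) = s≤s (s≤s z≤n)
  ... | _ | inj₂ (refl , _) | suc (suc _) = s≤s (s≤s z≤n)

  no-core-north-at-last : ∀ outer → ¬ T (ringNorth? 0 outer (4 + n'))
  no-core-north-at-last outer rewrite ≡ᵇ-refl (4 + n') = λ ()

  core-north-square-rows : ∀ outer r → T (ringNorth? 0 outer r) → (r <ᵇ 2) ≡ (next r <ᵇ 2)
  core-north-square-rows outer zero          _ = refl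
  core-north-square-rows outer (suc (suc s)) h with next-cases (2 + s)
  ... | inj₂ next≡3+s       rewrite next≡3+s = refl
  ... | inj₁ (2+s≡last , _) = ⊥-elim (no-core-north-at-last outer (subst (T ∘ ringNorth? 0 outer) 2+s≡last h))

module Layout (n' m k : ℕ) (k+1<m : suc k < m) where
  open Cycle (4 + n')
  open Rings n'

  -- Ring t consists of the columns k − t and k + 1 + t.
  ring : ℕ → ℕ
  ring c = (k ∸ c) + (c ∸ suc k)

  interior : ℕ → Bool
  interior c = (0 <ᵇ c) ∧ (suc c <ᵇ m)

  north? : ℕ → ℕ → Bool
  north? c r = ringNorth? (ring c) (interior c) r

  -- The rung between columns c and c + 1 belongs to the outer of the two, of ring ∣ c - k ∣.
  east? : ℕ → ℕ → Bool
  east? c r = rung? ∣ c - k ∣ r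

  open LocalCode m (4 + n') (s≤s (s≤s z≤n)) north? east?

  ring-left : ∀ {c} → c ≤ k → ring c ≡ k ∸ c
  ring-left {c} c≤k = trans (cong ((k ∸ c) +_) (m≤n⇒m∸n≡0 (m≤n⇒m≤1+n c≤k))) (+-identityʳ (k ∸ c))

  ring-right : ∀ {c} → k ≤ c → ring (suc c) ≡ c ∸ k
  ring-right {c} k≤c = cong (_+ (c ∸ k)) (m≤n⇒m∸n≡0 (m≤n⇒m≤1+n k≤c))

  degree-left : ∀ {c} r → c ≤ k → r < 5 + n' →
                ExactlyTwo (north? c r) (north? c (prev r)) (east? c r ∧ (suc c <ᵇ m)) (west? c r)
  degree-left {c} r c≤k r<n =
    ExactlyTwo-cong (north-eq r) (north-eq (prev r)) east-eq (west-eq c c≤k) (ring-degree (k ∸ c) (interior c) r r<n)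
    where
      open ≡-Reasoning
      north-eq : ∀ r → ringNorth? (k ∸ c) (interior c) r ≡ north? c r
      north-eq r = cong (λ t → ringNorth? t (interior c) r) (sym (ring-left c≤k))
      east-eq : rung? (k ∸ c) r ≡ rung? ∣ c - k ∣ r ∧ (suc c <ᵇ m)
      east-eq = begin
        rung? (k ∸ c) r                    ≡⟨ sym (∧-identityʳ (rung? (k ∸ c) r)) ⟩
        rung? (k ∸ c) r ∧ true             ≡⟨ cong₂ (λ t b → rung? t r ∧ b) (sym (m≤n⇒∣m-n∣≡n∸m c≤k))
                                                   (sym (<ᵇ-true (≤-<-trans (s≤s c≤k) k+1<m))) ⟩
        rung? ∣ c - k ∣ r ∧ (suc c <ᵇ m)   ∎
      west-eq : ∀ c → c ≤ k → rung? (suc (k ∸ c)) r ∧ interior c ≡ west? c r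
      west-eq zero     _      = ∧-zeroʳ (rung? (suc k) r)
      west-eq (suc c') 1+c'≤k = begin
        rung? (suc (k ∸ suc c')) r ∧ (suc (suc c') <ᵇ m) ≡⟨ cong (rung? (suc (k ∸ suc c')) r ∧_)
                                                              (<ᵇ-true (≤-<-trans (s≤s 1+c'≤k) k+1<m)) ⟩
        rung? (suc (k ∸ suc c')) r ∧ true                ≡⟨ ∧-identityʳ (rung? (suc (k ∸ suc c')) r) ⟩
        rung? (suc (k ∸ suc c')) r                       ≡⟨ cong (λ t → rung? t r) (sym (+-∸-assoc 1 1+c'≤k)) ⟩
        rung? (k ∸ c') r                                 ≡⟨ cong (λ t → rung? t r)
                                                              (sym (m≤n⇒∣m-n∣≡n∸m (≤-trans (n≤1+n c') 1+c'≤k))) ⟩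
        rung? ∣ c' - k ∣ r                               ∎

  degree-right : ∀ {c} r → k ≤ c → r < 5 + n' →
                 ExactlyTwo (north? (suc c) r) (north? (suc c) (prev r)) (east? (suc c) r ∧ (suc (suc c) <ᵇ m)) (east? c r)
  degree-right {c} r k≤c r<n
    rewrite ring-right k≤c | m≤n⇒∣n-m∣≡n∸m (m≤n⇒m≤1+n k≤c) | +-∸-assoc 1 k≤c | m≤n⇒∣n-m∣≡n∸m k≤c =
    ExactlyTwo-swapEW (ring-degree (c ∸ k) (interior (suc c)) r r<n)

  degree : ∀ p → InRange p → ExactlyTwo (has north p) (has south p) (has east p) (has west p)
  degree (c , r) (c<m , r<n) with c ≤? k
  ... | yes c≤k = degree-left r c≤k r<n
  ... | no  c≰k with ≰⇒> c≰k
  ...   | s≤s k≤c' = degree-right r k≤c' r<n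

  row< : ∀ {r} → r ≤ 4 → r < 5 + n'
  row< r≤4 = s≤s (≤-trans r≤4 (m≤m+n 4 n'))

  -- One side of the core: σ t is its column of ring t, and p its outermost ring.
  module Side (σ : ℕ → ℕ) (p : ℕ)
    (σ-bound   : ∀ {t} → t ≤ p → σ t < m)
    (ring-σ    : ∀ {t} → t ≤ p → ring (σ t) ≡ t)
    (outermost : interior (σ p) ≡ false)
    (rung-σ    : ∀ {t r} → t < p → r < 5 + n' → T (rung? (suc t) r) → (σ t , r) ~ (σ (suc t) , r))
    where

    north-off-gaps : ∀ {t i} → suc t ≤ p → i ≢ 2 → i ≢ 3 → T (north? (σ (suc t)) i)
    north-off-gaps {t} {i} t<p i≢2 i≢3 =
      subst (λ s → T (ringNorth? s (interior (σ (suc t))) i)) (sym (ring-σ t<p)) (ringNorth-off-gaps t _ i≢2 i≢3)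

    rungs : ∀ {t} → t < p → (σ t , gap (suc t)) ~ (σ (suc t) , gap (suc t)) ×
                             (σ t , suc (gap (suc t))) ~ (σ (suc t) , suc (gap (suc t)))
    rungs {t} t<p = rung-σ t<p (row< (m≤n⇒m≤1+n (gap≤3 (suc t)))) (rung-at-gap t) ,
                    rung-σ t<p (row< (s≤s (gap≤3 (suc t)))) (rung-above-gap t)

    rung-at-three : ∀ {t} → t < p → (σ t , 3) ~ (σ (suc t) , 3)
    rung-at-three {t} t<p = rung-σ t<p (row< (s≤s (s≤s (s≤s z≤n)))) (rung-three t)

    up-to-two : ∀ {t r} → suc t ≤ p → r ≤ 2 → (σ (suc t) , r) ~ (σ (suc t) , 2)
    up-to-two t<p r≤2 = column-walk (σ-bound t<p) 2 r≤2 (row< (s≤s (s≤s z≤n)))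
      (λ i _ i<2 → north-off-gaps t<p (<⇒≢ i<2) (<⇒≢ (m<n⇒m<1+n i<2)))

    around-to-zero : ∀ {t r} → suc t ≤ p → 4 ≤ r → r < 5 + n' → (σ (suc t) , r) ~ (σ (suc t) , 0)
    around-to-zero {t} t<p 4≤r (s≤s r≤last) =
      column-walk (σ-bound t<p) (4 + n') r≤last ≤-refl
        (λ i r≤i _ → let 4≤i = ≤-trans 4≤r r≤i in
                     north-off-gaps t<p (>⇒≢ (≤-trans (s≤s (s≤s (s≤s z≤n))) 4≤i)) (>⇒≢ 4≤i)) ◅◅
      subst (λ z → (σ (suc t) , 4 + n') ~ (σ (suc t) , z)) next-last
        (north-step (σ-bound t<p) ≤-refl (north-off-gaps t<p (λ ()) (λ ())))

    to-row-two : ∀ {t} → suc t ≤ p → ∀ r → r < 5 + n' → r ≢ 3 → (σ (suc t) , r) ~ (σ (suc t) , 2)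
    to-row-two t<p 0 _ _   = up-to-two t<p z≤n
    to-row-two t<p 1 _ _   = up-to-two t<p (s≤s z≤n)
    to-row-two t<p 2 _ _   = ε
    to-row-two t<p 3 _ r≢3 = ⊥-elim (r≢3 refl)
    to-row-two t<p (suc (suc (suc (suc s)))) r<n _ =
      around-to-zero t<p (s≤s (s≤s (s≤s (s≤s z≤n)))) r<n ◅◅ up-to-two t<p z≤n

    below-outer : ∀ d t → d + suc t ≡ p → suc t ≤ p
    below-outer d t d+1+t≡p = subst (suc t ≤_) d+1+t≡p (m≤n+m (suc t) d)

    outward : ∀ d t → suc d + suc t ≡ p → d + suc (suc t) ≡ p
    outward d t = trans (+-suc d (suc t))

    -- Downward induction from the outermost ring, where the north edge at the outer gap row is north-off-gaps.
    row-three-to-two : ∀ d t → d + suc t ≡ p → (σ (suc t) , 3) ~ (σ (suc t) , 2)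
    row-three-to-two zero t refl with gap (suc (suc t)) | gap-alternates (suc (suc t)) | outer-gap-edge
      where
        outer-gap-edge : (σ (suc t) , gap (suc (suc t))) ~ (σ (suc t) , next (gap (suc (suc t))))
        outer-gap-edge = north-step (σ-bound ≤-refl) (row< (m≤n⇒m≤1+n (gap≤3 (suc (suc t)))))
          (subst₂ (λ s o → T (ringNorth? s o (gap (suc (suc t))))) (sym (ring-σ ≤-refl)) (sym outermost)
            (ringNorth-outer-gap t))
    ... | _ | inj₁ (refl , _) | two→three  = ~-sym two→three
    ... | _ | inj₂ (refl , _) | three→four = three→four ◅◅ to-row-two ≤-refl 4 (row< ≤-refl) (λ ())
    row-three-to-two (suc d) t e
      with gap (suc (suc t)) | gap-alternates (suc (suc t)) | rungs (below-outer d (suc t) (outward d t e))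
    ... | _ | inj₁ (refl , _) | at-two , at-three =
      at-three ◅◅ row-three-to-two d (suc t) (outward d t e) ◅◅ ~-sym at-two
    ... | _ | inj₂ (refl , _) | at-three , at-four =
      at-three ◅◅ row-three-to-two d (suc t) (outward d t e) ◅◅
      ~-sym (to-row-two (below-outer d (suc t) (outward d t e)) 4 (row< ≤-refl) (λ ())) ◅◅
      ~-sym at-four ◅◅ to-row-two (below-outer (suc d) t e) 4 (row< ≤-refl) (λ ())

    column-to-row-two : ∀ {t} → suc t ≤ p → ∀ r → r < 5 + n' → (σ (suc t) , r) ~ (σ (suc t) , 2)
    column-to-row-two {t} t<p r r<n with r ≟ 3
    ... | yes refl = row-three-to-two (p ∸ suc t) t (m∸n+n≡m t<p)
    ... | no r≢3   = to-row-two t<p r r<n r≢3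

    to-core : ∀ t → suc t ≤ p → ∀ r → r < 5 + n' → (σ (suc t) , r) ~ (σ 0 , 3)
    to-core t t<p r r<n =
      column-to-row-two t<p r r<n ◅◅ ~-sym (column-to-row-two t<p 3 (row< (n≤1+n 3))) ◅◅
      ~-sym (rung-at-three t<p) ◅◅ inward t (<⇒≤ t<p)
      where
        inward : ∀ t → t ≤ p → (σ t , 3) ~ (σ 0 , 3)
        inward zero    _   = ε
        inward (suc t) t<p = to-core t t<p 3 (row< (n≤1+n 3))

    core-two-three : (σ 0 , 2) ~ (σ 0 , 3)
    core-two-three with m≤n⇒m<n∨m≡n (z≤n {p})
    ... | inj₂ 0≡p = north-step (σ-bound z≤n) (row< (s≤s (s≤s z≤n))) north-at-two
      where
        north-at-two : T (north? (σ 0) 2)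
        north-at-two = subst₂ (λ s o → T (ringNorth? s o 2)) (sym (ring-σ z≤n))
                         (sym (subst (λ q → interior (σ q) ≡ false) (sym 0≡p) outermost)) _
    ... | inj₁ 0<p = rung-σ 0<p (row< (s≤s (s≤s z≤n))) _ ◅◅
                     ~-sym (column-to-row-two 0<p 3 (row< (n≤1+n 3))) ◅◅ ~-sym (rung-at-three 0<p)

  σL σR : ℕ → ℕ
  σL t = k ∸ t
  σR t = suc t + k

  pR : ℕ
  pR = m ∸ suc (suc k)

  σL-bound : ∀ {t} → t ≤ k → σL t < m
  σL-bound {t} _ = ≤-<-trans (m∸n≤m k t) (<-trans (n<1+n k) k+1<m)

  σL-ring : ∀ {t} → t ≤ k → ring (σL t) ≡ t
  σL-ring {t} t≤k = trans (ring-left (m∸n≤m k t)) (m∸[m∸n]≡n t≤k)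

  σL-rung : ∀ {t r} → t < k → r < 5 + n' → T (rung? (suc t) r) → (σL t , r) ~ (σL (suc t) , r)
  σL-rung {t} {r} t<k r<n h = ~-sym (subst (λ c → (σL (suc t) , r) ~ (c , r)) inner≡
      (east-step (subst (_< m) (sym inner≡) (σL-bound (<⇒≤ t<k))) r<n
        (subst (λ s → T (rung? s r)) (sym index) h)))
    where
      inner≡ : suc (k ∸ suc t) ≡ k ∸ t
      inner≡ = sym (+-∸-assoc 1 t<k)
      index : ∣ k ∸ suc t - k ∣ ≡ suc t
      index = trans (m≤n⇒∣m-n∣≡n∸m (m∸n≤m k (suc t))) (m∸[m∸n]≡n t<k)

  σR-bound : ∀ {t} → t ≤ pR → σR t < m
  σR-bound {t} t≤pR = begin-strict
    suc t + k             <⟨ s≤s (≤-reflexive (sym (+-suc t k))) ⟩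
    suc (t + suc k)       ≡⟨ sym (+-suc t (suc k)) ⟩
    t + suc (suc k)       ≤⟨ +-monoˡ-≤ (suc (suc k)) t≤pR ⟩
    pR + suc (suc k)      ≡⟨ m∸n+n≡m k+1<m ⟩
    m                     ∎
    where open ≤-Reasoning

  σR-ring : ∀ {t} → t ≤ pR → ring (σR t) ≡ t
  σR-ring {t} _ = trans (ring-right (m≤n+m k t)) (m+n∸n≡m t k)

  σR-outermost : interior (σR pR) ≡ false
  σR-outermost = <ᵇ-false (≤-reflexive (sym (begin
    suc (suc pR + k)      ≡⟨ cong suc (sym (+-suc pR k)) ⟩
    suc (pR + suc k)      ≡⟨ sym (+-suc pR (suc k)) ⟩
    pR + suc (suc k)      ≡⟨ m∸n+n≡m k+1<m ⟩
    m                     ∎)))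
    where open ≡-Reasoning

  σR-rung : ∀ {t r} → t < pR → r < 5 + n' → T (rung? (suc t) r) → (σR t , r) ~ (σR (suc t) , r)
  σR-rung {t} {r} t<pR r<n h = east-step (σR-bound t<pR) r<n (subst (λ s → T (rung? s r)) (sym index) h)
    where
      index : ∣ suc t + k - k ∣ ≡ suc t
      index = trans (m≤n⇒∣n-m∣≡n∸m (m≤n+m k (suc t))) (m+n∸n≡m (suc t) k)

  module LS = Side σL k σL-bound σL-ring (cong interior (n∸n≡0 k)) σL-rung
  module RS = Side σR pR σR-bound σR-ring σR-outermost σR-rung

  ring-k : ring k ≡ 0
  ring-k = σL-ring z≤n

  ring-suc-k : ring (suc k) ≡ 0
  ring-suc-k = σR-ring z≤n

  core-rung : ∀ {r} → r < 5 + n' → T (rung? 0 r) → (k , r) ~ (suc k , r)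
  core-rung {r} r<n h = east-step k+1<m r<n (subst (λ s → T (rung? s r)) (sym (∣n-n∣≡0 k)) h)

  core-north-zero : ∀ {c} → ring c ≡ 0 → T (north? c 0)
  core-north-zero {c} ring≡0 = subst (λ s → T (ringNorth? s (interior c) 0)) (sym ring≡0) _

  core-rise : ∀ {c r} → c < m → ring c ≡ 0 → 3 ≤ r → r < 5 + n' → (c , 3) ~ (c , r)
  core-rise {c} {r} c<m ring≡0 3≤r r<n = column-walk c<m r 3≤r r<n λ i 3≤i i<r →
    subst (λ s → T (ringNorth? s (interior c) i)) (sym ring≡0)
      (ringNorth-core-middle (interior c) 3≤i (<-≤-trans i<r (≤-pred r<n)))

  core-bridge : (k , 3) ~ (suc k , 3)
  core-bridge =
    core-rise (<-trans (n<1+n k) k+1<m) ring-k 3≤last ≤-refl ◅◅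
    core-rung ≤-refl (≡⇒≡ᵇ (4 + n') (4 + n') refl) ◅◅
    ~-sym (core-rise k+1<m ring-suc-k 3≤last ≤-refl)
    where 3≤last = s≤s (s≤s (s≤s z≤n))

  inSquare : Point → Bool
  inSquare (c , r) = (r <ᵇ 2) ∧ (ring c ≡ᵇ 0)

  inSquare-north : ∀ {c r} → c < m → r < 5 + n' → T (north? c r) → inSquare (c , r) ≡ inSquare (c , next r)
  inSquare-north {c} {r} _ _ h with ring c
  ... | zero  = cong (_∧ true) (core-north-square-rows (interior c) r h)
  ... | suc _ = trans (∧-zeroʳ (r <ᵇ 2)) (sym (∧-zeroʳ (next r <ᵇ 2)))

  inSquare-east : ∀ {c r} → T (east? c r) → inSquare (c , r) ≡ inSquare (suc c , r)
  inSquare-east {c} {r} h with ∣ c - k ∣ in index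
  ... | zero with ∣m-n∣≡0⇒m≡n {c} {k} index
  ...   | refl rewrite ring-k | ring-suc-k = refl
  inSquare-east {c} {r} h | suc t rewrite <ᵇ-false (rung-off-square t {r} h) = refl

  hub : Bool → Point
  hub true  = k , 0
  hub false = suc k , 3

  data Column : ℕ → Set where
    core₀ : Column k
    core₁ : Column (suc k)
    left  : ∀ t → suc t ≤ k  → Column (σL (suc t))
    right : ∀ t → suc t ≤ pR → Column (σR (suc t))

  column : ∀ {c} → c < m → Column c
  column {c} c<m with <-cmp c k
  ... | tri≈ _ refl _ = core₀
  ... | tri< c<k _ _  = subst Column (trans (cong (k ∸_) outer≡) (m∸[m∸n]≡n (<⇒≤ c<k)))
                          (left (k ∸ suc c) (subst (_≤ k) (sym outer≡) (m∸n≤m k c)))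
    where
      outer≡ : suc (k ∸ suc c) ≡ k ∸ c
      outer≡ = sym (+-∸-assoc 1 c<k)
  ... | tri> _ _ k<c with m≤n⇒m<n∨m≡n k<c
  ...   | inj₂ refl  = core₁
  ...   | inj₁ k+1<c = subst Column σR≡c
                         (right t (subst (_≤ pR) (+-∸-assoc 1 k+1<c) (∸-monoˡ-≤ (suc (suc k)) c<m)))
    where
      t = c ∸ suc (suc k)
      σR≡c : σR (suc t) ≡ c
      σR≡c = trans (sym (trans (+-suc t (suc k)) (cong suc (+-suc t k)))) (m∸n+n≡m k+1<c)

  core₀-to-hub : ∀ r → r < 5 + n' → (k , r) ~ hub ((r <ᵇ 2) ∧ true)
  core₀-to-hub 0 _ = ε
  core₀-to-hub 1 _ = ~-sym (north-step (<-trans (n<1+n k) k+1<m) (s≤s z≤n) (core-north-zero {k} ring-k))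
  core₀-to-hub 2 _ = core-rung (row< (s≤s (s≤s z≤n))) _ ◅◅ RS.core-two-three
  core₀-to-hub (suc (suc (suc s))) r<n =
    ~-sym (core-rise (<-trans (n<1+n k) k+1<m) ring-k (s≤s (s≤s (s≤s z≤n))) r<n) ◅◅ core-bridge

  core₁-to-hub : ∀ r → r < 5 + n' → (suc k , r) ~ hub ((r <ᵇ 2) ∧ true)
  core₁-to-hub 0 r<n = ~-sym (core-rung r<n _)
  core₁-to-hub 1 r<n = ~-sym (core-rung r<n _) ◅◅ core₀-to-hub 1 r<n
  core₁-to-hub 2 _   = RS.core-two-three
  core₁-to-hub (suc (suc (suc s))) r<n = ~-sym (core-rise k+1<m ring-suc-k (s≤s (s≤s (s≤s z≤n))) r<n)

  column-to-hub : ∀ {c} → Column c → ∀ r → r < 5 + n' → (c , r) ~ hub (inSquare (c , r))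
  column-to-hub core₀ r r<n rewrite ring-k     = core₀-to-hub r r<n
  column-to-hub core₁ r r<n rewrite ring-suc-k = core₁-to-hub r r<n
  column-to-hub (left t t<k) r r<n rewrite σL-ring t<k | ∧-zeroʳ (r <ᵇ 2) =
    LS.to-core t t<k r r<n ◅◅ core-bridge
  column-to-hub (right t t<pR) r r<n rewrite σR-ring t<pR | ∧-zeroʳ (r <ᵇ 2) =
    RS.to-core t t<pR r r<n

  core-column-separates : ∀ {i j j'} → toℕ i ≡ k ⊎ toℕ i ≡ suc k → toℕ j < 2 → 2 ≤ toℕ j' →
                          SeparatingTwoFactor m (5 + n') (i , j) (i , j')
  core-column-separates {i} {j} {j'} i-core j<2 2≤j' =
    F , isTwoFactor degree ,
    separates-by-hubs inSquare (Move-invariant inSquare inSquare-north inSquare-east) hub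
      (λ { (c , r) (c<m , r<n) → column-to-hub (column c<m) r r<n }) apart
    where
      ring-i : ring (toℕ i) ≡ 0
      ring-i = [ (λ i≡k → trans (cong ring i≡k) ring-k) , (λ i≡1+k → trans (cong ring i≡1+k) ring-suc-k) ]′
                 i-core
      apart : inSquare (pos (i , j)) ≢ inSquare (pos (i , j'))
      apart rewrite ring-i | <ᵇ-true j<2 | <ᵇ-false 2≤j' = λ ()

module RowReduction (n' : ℕ) {m : ℕ} (2≤m : 2 ≤ m) (i : Fin m) where
  open Cycle (4 + n')

  beyond-row-one : (j' : Fin (5 + n')) → j' ≢ fzero → j' ≢ rotate fzero → 2 ≤ toℕ j'
  beyond-row-one j' j'≢0 j'≢1 with toℕ j' in j'≡
  ... | zero          = ⊥-elim (j'≢0 (toℕ-injective j'≡))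
  ... | suc zero      = ⊥-elim (j'≢1 (toℕ-injective (trans j'≡ (sym (toℕ-rotate fzero)))))
  ... | suc (suc _)   = s≤s (s≤s z≤n)

  from-row-zero : (j' : Fin (5 + n')) → j' ≢ fzero → j' ≢ rotate fzero →
                  SeparatingTwoFactor m (5 + n') (i , fzero) (i , j')
  from-row-zero j' j'≢0 j'≢1 with suc (toℕ i) <? m | toℕ i in i≡
  ... | yes 1+i<m | _     = Layout.core-column-separates n' m (toℕ i) 1+i<m (inj₁ refl) (s≤s z≤n)
                              (beyond-row-one j' j'≢0 j'≢1)
  ... | no  1+i≮m | zero  = ⊥-elim (1+i≮m (subst (λ c → suc c < m) (sym i≡) 2≤m))
  ... | no  _     | suc k = Layout.core-column-separates n' m k (subst (_< m) i≡ (toℕ<n i)) (inj₂ i≡) (s≤s z≤n)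
                              (beyond-row-one j' j'≢0 j'≢1)

  off-next-row : ∀ t (j j' : Fin (5 + n')) → toℕ j ≡ t → j' ≢ j → j' ≢ rotate j →
                 SeparatingTwoFactor m (5 + n') (i , j) (i , j')
  off-next-row zero j j' j≡0 j'≢j j'≢next with toℕ-injective {i = j} {j = fzero} j≡0
  ... | refl = from-row-zero j' j'≢j j'≢next
  off-next-row (suc t) j j' j≡1+t j'≢j j'≢next =
    subst₂ (λ x y → SeparatingTwoFactor m (5 + n') (i , x) (i , y)) (rotate-unrotate j) (rotate-unrotate j')
      (separating-transport (rowRotation m)
        (off-next-row t (unrotate j) (unrotate j') (trans (toℕ-unrotate j) (cong prev j≡1+t))
          (λ e → j'≢j (unrotate-injective e))
          (λ e → j'≢next (unrotate-injective (trans e (trans (rotate-unrotate j) (sym (unrotate-rotate j))))))))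

  in-column : ∀ j j' → j ≢ j' → SeparatingTwoFactor m (5 + n') (i , j) (i , j')
  in-column j j' j≢j' with j' ≟ᶠ rotate j
  ... | no  j'≢next = off-next-row (toℕ j) j j' refl (λ e → j≢j' (sym e)) j'≢next
  ... | yes refl    = separating-sym (off-next-row (toℕ (rotate j)) (rotate j) j refl j≢j' (rotate²≢ (s≤s (s≤s z≤n)) j))

separating-two-factor : ∀ m n → 2 ≤ m → 5 ≤ n → (i : Fin m) (j j' : Fin n) → j ≢ j' →
                        SeparatingTwoFactor m n (i , j) (i , j')
separating-two-factor m (suc (suc (suc (suc (suc n'))))) 2≤m (s≤s (s≤s (s≤s (s≤s (s≤s z≤n))))) i =
  RowReduction.in-column n' 2≤m i

lemma3p2 : (m n : ℕ) → 3 ≤ m → 5 ≤ n → Odd n →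
    (i : Fin m) (j j' : Fin n) → j ≢ j' →
    Σ (Vertex m n → Vertex m n → Bool) λ F →
    IsTwoFactor m n F × Separates F (i , j) (i , j')
lemma3p2 m n 3≤m 5≤n _ = separating-two-factor m n (≤-trans (n≤1+n 2) 3≤m) 5≤n
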